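{- Let $P$ be a self-dual poset. Let $f\in\mathrm{Inc}^q(P)$ and let $\mathcal{O}$ be the promotion orbit of $f$ in $\mathrm{Inc}^q(P)$. Let $r$ be the largest label in $\overline{f}$ and $\overline{\mathcal{O}}$ be the orbit of $\overline{f}\in\mathrm{Inc}^r(P)$. Suppose the following hold: \begin{itemize} \item $\rho^i(\mathrm{Con}(f))=\mathrm{rev}(\mathrm{Con}(f))$ for some $i\in[q]$. \item $|\mathcal{O}|=|\overline{\mathcal{O}}| \ell$ where $\ell$ is the period of $\mathrm{Con}(f)$. \item $\overline{\mathcal{O}}$ is swap-closed. \end{itemize} Then the orbit $\mathcal{O}$ is orbitmesic with respect to the antipodal sum statistic $\mathcal{A}_x$ for all $x\in P$ and the total sum statistic $\mathrm{Tot}$.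
   Context: $P$ is a finite self-dual poset with fixed order-reversing involution $\kappa$. $\mathrm{Inc}^q(P)$ is the set of increasing labelings $f:P\to[q]$ ($f(x)<f(y)$ whenever $x<y$). Promotion $\mathrm{Pro}$: replace labels $1$ by empty boxes; for $i=2,\dots,q$ slide boxes upward past labels $i$ (a box at $x$ becomes $i$ if some $y\gtrdot x$ is labeled $i$, which becomes a box); replace boxes by $q+1$ and subtract $1$ from all labels. The binary content word $\mathrm{Con}(f)=(c_1,\dots,c_q)$ has $c_i=1$ iff some element is labeled $i$; $\rho$ is the cyclic shift $\rho(v_1,\dots,v_q)=(v_2,\dots,v_q,v_1)$, $\mathrm{rev}$ reverses a vector, and the period of a word is the least $\ell$ with $\rho^\ell$ fixing it. The deflation $\overline{f}$ replaces the $j$-th smallest label used by $f$ with $j$. $\mathrm{swap}(f)(x)=q+1-f(\kappa(x))$ (on $\mathrm{Inc}^r(P)$ use $r$ in place of $q$); an orbit is swap-closed if swap maps it to itself. $\mathcal{A}_x(f)=f(x)+f(\kappa(x))$, $\mathrm{Tot}(f)=\sum_{x\in P} f(x)$. Orbitmesic: orbit average of the statistic equals its average over all of $\mathrm{Inc}^q(P)$. -}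

module Defs where

open import Level using (0ℓ)
open import Data.Bool using (Bool; true; false; if_then_else_; _∧_; _∨_; not)
open import Data.Nat using (ℕ; zero; suc; _+_; _*_; _∸_; _≤_; _<_; _≡ᵇ_; _<ᵇ_; _≤ᵇ_)
open import Data.Fin using (Fin)
open import Data.List using (List; []; _∷_; _++_; [_]; map; filter; upTo; length; foldl; concatMap; reverse)
open import Data.Bool.ListAction using (any; all)
open import Data.Nat.ListAction using (sum)
open import Data.List.Membership.Propositional using (_∈_)
open import Data.Vec using (Vec; lookup; tabulate; toList)
import Data.Vec as Vec
open import Data.Fin.Properties using () renaming (_≟_ to _≟ᶠ_)
open import Data.List.Base using () renaming (allFin to allFinL)
open import Relation.Binary using (Rel; Decidable; IsPartialOrder)
open import Relation.Binary.PropositionalEquality using (_≡_; _≢_)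
open import Relation.Nullary.Decidable using (⌊_⌋)
open import Data.Product using (_×_)

record FinPoset (n : ℕ) : Set₁ where
  field
    _≼_            : Rel (Fin n) 0ℓ
    _≼?_           : Decidable _≼_
    isPartialOrder : IsPartialOrder _≡_ _≼_

record SelfDualPoset (n : ℕ) : Set₁ where
  field
    poset      : FinPoset n
  open FinPoset poset public
  field
    κ          : Fin n → Fin n
    κ-invol    : ∀ x → κ (κ x) ≡ x
    κ-reversing : ∀ x y → x ≼ y → κ y ≼ κ x

module _ {n : ℕ} (P : SelfDualPoset n) where
  open SelfDualPoset P

  ltᵇ : Fin n → Fin n → Bool
  ltᵇ x y = ⌊ x ≼? y ⌋ ∧ not ⌊ x ≟ᶠ y ⌋

  coverᵇ : Fin n → Fin n → Bool
  coverᵇ x y = ltᵇ x y ∧ not (any (λ z → ltᵇ x z ∧ ltᵇ z y) (allFinL n))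

Labeling : ℕ → Set
Labeling n = Vec ℕ n

oneTo : ℕ → List ℕ
oneTo q = map suc (upTo q)

allLabelings : (q n : ℕ) → List (Labeling n)
allLabelings q zero = Vec.[] ∷ []
allLabelings q (suc n) = concatMap (λ v → map (λ a → a Vec.∷ v) (oneTo q)) (allLabelings q n)

module _ {n : ℕ} (P : SelfDualPoset n) where
  open SelfDualPoset P

  isIncᵇ : Labeling n → Bool
  isIncᵇ f = all (λ x → all (λ y → not (ltᵇ P x y) ∨ (lookup f x <ᵇ lookup f y)) (allFinL n)) (allFinL n)

  Inc : ℕ → List (Labeling n)
  Inc q = filter (λ f → isIncᵇ f Data.Bool.≟ true) (allLabelings q n)

  -- Promotion on Inc^q(P).  Empty boxes are represented by the label 0
  -- (genuine labels are ≥ 1).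

  slideStep : ℕ → Labeling n → Labeling n
  slideStep i g = tabulate λ x →
    if (lookup g x ≡ᵇ 0) ∧ any (λ y → coverᵇ P x y ∧ (lookup g y ≡ᵇ i)) (allFinL n)
    then i
    else (if (lookup g x ≡ᵇ i) ∧ any (λ z → coverᵇ P z x ∧ (lookup g z ≡ᵇ 0)) (allFinL n)
          then 0
          else lookup g x)

  Pro : ℕ → Labeling n → Labeling n
  Pro q f =
    Vec.map (λ a → if a ≡ᵇ 0 then q else a ∸ 1)       -- boxes ↦ q+1, then subtract 1
      (foldl (λ g i → slideStep i g)                  -- i = 2, …, q in order
             (Vec.map (λ a → if a ≡ᵇ 1 then 0 else a) f)
             (map (2 +_) (upTo (q ∸ 1))))

  swap : ℕ → Labeling n → Labeling n
  swap q f = tabulate λ x → suc q ∸ lookup f (κ x)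

  antipodal : Fin n → Labeling n → ℕ
  antipodal x f = lookup f x + lookup f (κ x)

  tot : Labeling n → ℕ
  tot f = sum (toList f)

iter : {A : Set} → ℕ → (A → A) → A → A
iter zero    h a = a
iter (suc k) h a = h (iter k h a)

rot : List Bool → List Bool
rot []       = []
rot (a ∷ as) = as ++ [ a ]

usedᵇ : {n : ℕ} → Labeling n → ℕ → Bool
usedᵇ f i = any (λ a → a ≡ᵇ i) (toList f)

Con : {n : ℕ} → ℕ → Labeling n → List Bool
Con q f = map (usedᵇ f) (oneTo q)

-- deflation: the j-th smallest used label becomes j, i.e. f̄(x) is the
-- number of used labels ≤ f(x)
deflate : {n : ℕ} → Labeling n → Labeling n
deflate f = Vec.map (λ a → length (filter (λ i → usedᵇ f i Data.Bool.≟ true) (oneTo a))) f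

IsPeriod : List Bool → ℕ → Set
IsPeriod w ℓ = (1 ≤ ℓ) × (iter ℓ rot w ≡ w) × (∀ k → 1 ≤ k → k < ℓ → iter k rot w ≢ w)

IsOrbitSize : {A : Set} → (A → A) → A → ℕ → Set
IsOrbitSize h a m = (1 ≤ m) × (iter m h a ≡ a) × (∀ k → 1 ≤ k → k < m → iter k h a ≢ a)

orbitList : {A : Set} → (A → A) → A → ℕ → List A
orbitList h a m = map (λ k → iter k h a) (upTo m)

-- orbitmesic: (Σ_O stat)/|O| = (Σ_S stat)/|S|, cross-multiplied
Orbitmesic : {A : Set} → (A → ℕ) → List A → List A → Set
Orbitmesic stat O S = sum (map stat O) * length S ≡ sum (map stat S) * length O

SwapClosed : {A : Set} → (A → A) → List A → Set
SwapClosed sw O = ∀ g → g ∈ O → sw g ∈ O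

-- r = the largest label of the deflation = number of distinct labels used
-- (labels are in [q])
usedCount : {n : ℕ} → ℕ → Labeling n → ℕ
usedCount q f = length (filter (λ i → usedᵇ f i Data.Bool.≟ true) (oneTo q))

{-# OPTIONS --safe #-}
-- Write f = inflate c f̄ with c = Con f: inflating by a word c replaces the label j by the position of
-- the j-th true of c. Promotion respects this encoding, Pro_q (inflate c g) = inflate (ρ c) (Pro_r^ε g)
-- with ε = 1 exactly when c starts with true, so Pro_q^k f = inflate (ρ^k c) (Pro_r^(N k) f̄) is
-- determined by the pair (k mod ℓ, N k mod |Ō|). The iterates in O are distinct and |O| = |Ō| ℓ, so every
-- such pair is realised in O. Swap respects the encoding too, swap_q (inflate c g) = inflate (rev c) (swap_r g),
-- and rev c = ρ^i c makes every rev (ρ^k c) a rotation of c; with Ō swap-closed, O is swap-closed.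
-- Finally swap is an involution on O and on Inc^q(P) with A_x g + A_x (swap g) = 2 (q + 1) and
-- Tot g + Tot (swap g) = n (q + 1), so on both the averages are half of these constants.
module Submission where

open import Defs
open import Data.Bool using (Bool; true; false; if_then_else_; _∧_; _∨_; not; T)
import Data.Bool as Bool
open import Data.Bool.ListAction using (any; or)
open import Data.Bool.Properties using (⇔→≡; T-≡; ¬-not; ∧-zeroʳ; ∨-zeroʳ)
open import Data.Empty using (⊥-elim)
open import Data.Fin using (Fin; zero; suc; toℕ; fromℕ<; combine; remQuot; punchOut)
open import Data.Fin.Properties
  using (toℕ-fromℕ<; toℕ-injective; toℕ<n; remQuot-combine; injective⇒≤; punchOut-injective; any?)
  renaming (_≟_ to _≟ᶠ_)
open import Data.List
  using (List; []; _∷_; _++_; [_]; map; length; upTo; applyUpTo; reverse; filter; foldl; concatMap; cartesianProductWith)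
open import Data.List.Base using () renaming (allFin to allFinL)
import Data.List as List
import Data.List.Properties as List
open import Data.List.Membership.Propositional using (_∈_)
open import Data.List.Membership.Propositional.Properties
  using (∈-map⁺; ∈-map⁻; ∈-upTo⁺; ∈-upTo⁻; ∈-cartesianProductWith⁺; ∈-cartesianProductWith⁻; ∈-filter⁺; ∈-filter⁻; ∈-allFin)
open import Data.List.Membership.Propositional.Properties.WithK using (unique∧set⇒bag)
open import Data.List.Properties
  using (map-∘; length-map; length-upTo; map-upTo; map-++; length-++; ++-assoc; ++-identityʳ; unfold-reverse;
         reverse-++; length-reverse)
open import Data.List.Relation.Binary.BagAndSetEquality using (∼bag⇒↭)
open import Data.List.Relation.Binary.Permutation.Propositional using (_↭_)
import Data.List.Relation.Binary.Permutation.Propositional.Properties as ↭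
open import Data.List.Relation.Unary.All as All using (All; []; _∷_)
open import Data.List.Relation.Unary.All.Properties using (all⁺; all⁻; tabulate⁺)
open import Data.List.Relation.Unary.Any using (here; there)
open import Data.List.Relation.Unary.Unique.Propositional using (Unique; []; _∷_)
import Data.List.Relation.Unary.Unique.Propositional.Properties as Unique
open import Data.List.Relation.Unary.Unique.Propositional.Properties using (upTo⁺; allFin⁺; cartesianProductWith⁺)
open import Data.Nat using (ℕ; zero; suc; _+_; _*_; _∸_; _≤_; _<_; z≤n; s≤s; s≤s⁻¹; _≡ᵇ_; _<ᵇ_; NonZero)
open import Data.Nat.DivMod using (_%_; _/_; m≡m%n+[m/n]*n; m%n<n)
open import Data.Nat.ListAction using (sum)
open import Data.Nat.ListAction.Properties using (sum-↭)
open import Data.Nat.Properties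
open import Algebra.Properties.CommutativeSemigroup +-commutativeSemigroup using (interchange)
open import Data.Product using (Σ; ∃; _×_; _,_; proj₁; proj₂)
open import Data.Sum using (_⊎_; inj₁; inj₂)
open import Data.Vec using (Vec; lookup; tabulate)
import Data.Vec as Vec
import Data.Vec.Properties as Vec
open import Data.Vec.Properties using (lookup∘tabulate; tabulate∘lookup; tabulate-cong; lookup-map)
open import Function using (_∘_; mk⇔; Equivalence)
open import Function.Definitions using (Injective)
open import Relation.Binary using (tri<; tri≈; tri>)
open import Relation.Binary.PropositionalEquality hiding ([_])
open import Relation.Nullary using (yes; no; contradiction)


module _ {A : Set} where

  sum-map-+ : (f g : A → ℕ) (xs : List A) →
              sum (map (λ a → f a + g a) xs) ≡ sum (map f xs) + sum (map g xs)
  sum-map-+ f g []       = refl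
  sum-map-+ f g (x ∷ xs) =
    trans (cong (f x + g x +_) (sum-map-+ f g xs)) (interchange (f x) (g x) _ _)

  sum-map-const : ∀ {c} (f : A → ℕ) (xs : List A) → (∀ {a} → a ∈ xs → f a ≡ c) →
                  sum (map f xs) ≡ c * length xs
  sum-map-const {c} f []       _   = sym (*-zeroʳ c)
  sum-map-const {c} f (x ∷ xs) f≡c =
    trans (cong₂ _+_ (f≡c (here refl)) (sum-map-const f xs (f≡c ∘ there))) (sym (*-suc c (length xs)))

  Unique-map⁺-local : {B : Set} (F : A → B) {xs : List A} →
                      (∀ {x y} → x ∈ xs → y ∈ xs → F x ≡ F y → x ≡ y) →
                      Unique xs → Unique (map F xs)
  Unique-map⁺-local F inj []            = []
  Unique-map⁺-local F inj (x∉ ∷ unique) =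
    apart x∉ (λ y∈ → inj (here refl) (there y∈)) ∷ Unique-map⁺-local F (λ p q → inj (there p) (there q)) unique
    where
    apart : ∀ {x ys} → All (x ≢_) ys → (∀ {y} → y ∈ ys → F x ≡ F y → x ≡ y) → All (F x ≢_) (map F ys)
    apart []           _   = []
    apart (x≢y ∷ x≢ys) inj = (x≢y ∘ inj (here refl)) ∷ apart x≢ys (inj ∘ there)

  any-cong : ∀ {p p′ : A → Bool} → (∀ x → p x ≡ p′ x) → ∀ xs → any p xs ≡ any p′ xs
  any-cong p≗p′ xs = cong or (List.map-cong p≗p′ xs)

  any-false : ∀ {p : A → Bool} → (∀ x → p x ≡ false) → ∀ xs → any p xs ≡ false
  any-false p≗false []       = refl
  any-false p≗false (x ∷ xs) = cong₂ _∨_ (p≗false x) (any-false p≗false xs)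

  record InvolutionOn (σ : A → A) (xs : List A) : Set where
    field
      closed     : ∀ {x} → x ∈ xs → σ x ∈ xs
      involutive : ∀ {x} → x ∈ xs → σ (σ x) ≡ x

  module _ {σ : A → A} {xs : List A} (unique : Unique xs) (inv : InvolutionOn σ xs) where
    open InvolutionOn inv

    map-involution-↭ : map σ xs ↭ xs
    map-involution-↭ = ∼bag⇒↭ (unique∧set⇒bag
      (Unique-map⁺-local σ (λ p q e → trans (sym (involutive p)) (trans (cong σ e) (involutive q))) unique)
      unique (mk⇔ to from))
      where
      to : ∀ {z} → z ∈ map σ xs → z ∈ xs
      to z∈ with _ , x∈ , refl ← ∈-map⁻ σ z∈ = closed x∈
      from : ∀ {z} → z ∈ xs → z ∈ map σ xs
      from z∈ = subst (_∈ map σ xs) (involutive z∈) (∈-map⁺ σ (closed z∈))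

    sum-map-involution : (f : A → ℕ) → sum (map (f ∘ σ) xs) ≡ sum (map f xs)
    sum-map-involution f = trans (cong sum (map-∘ xs)) (sum-↭ (↭.map⁺ f map-involution-↭))

    sum-complementary : ∀ {c} (f : A → ℕ) → (∀ {x} → x ∈ xs → f x + f (σ x) ≡ c) →
                        2 * sum (map f xs) ≡ c * length xs
    sum-complementary {c} f f+fσ≡c = begin
      2 * sum (map f xs)                          ≡⟨ cong (S +_) (+-identityʳ S) ⟩
      S + S                                       ≡⟨ cong (S +_) (sum-map-involution f) ⟨
      S + sum (map (f ∘ σ) xs)                    ≡⟨ sum-map-+ f (f ∘ σ) xs ⟨
      sum (map (λ x → f x + f (σ x)) xs)          ≡⟨ sum-map-const _ xs f+fσ≡c ⟩
      c * length xs                               ∎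
      where
      open ≡-Reasoning
      S : ℕ
      S = sum (map f xs)

cross-multiply-halves : ∀ a b {c m s} → 2 * a ≡ c * m → 2 * b ≡ c * s → a * s ≡ b * m
cross-multiply-halves a b {c} {m} {s} 2a≡cm 2b≡cs = *-cancelˡ-≡ (a * s) (b * m) 2 (begin
  2 * (a * s) ≡⟨ *-assoc 2 a s ⟨
  2 * a * s   ≡⟨ cong (_* s) 2a≡cm ⟩
  c * m * s   ≡⟨ *-assoc c m s ⟩
  c * (m * s) ≡⟨ cong (c *_) (*-comm m s) ⟩
  c * (s * m) ≡⟨ *-assoc c s m ⟨
  c * s * m   ≡⟨ cong (_* m) 2b≡cs ⟨
  2 * b * m   ≡⟨ *-assoc 2 b m ⟩
  2 * (b * m) ∎)
  where open ≡-Reasoning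

-- both averages equal c/2
Orbitmesic-complementary : ∀ {A : Set} {σ : A → A} {O S : List A} {c} (stat : A → ℕ) →
  Unique O → InvolutionOn σ O → Unique S → InvolutionOn σ S →
  (∀ {g} → g ∈ O → stat g + stat (σ g) ≡ c) → (∀ {g} → g ∈ S → stat g + stat (σ g) ≡ c) →
  Orbitmesic stat O S
Orbitmesic-complementary {O = O} {S} {c} stat O! σO S! σS complO complS =
  cross-multiply-halves (sum (map stat O)) (sum (map stat S)) {c}
    (sum-complementary O! σO stat complO) (sum-complementary S! σS stat complS)

≡ᵇ-injective : ∀ (φ : ℕ → ℕ) {a b} → (φ a ≡ φ b → a ≡ b) → (φ a ≡ᵇ φ b) ≡ (a ≡ᵇ b)
≡ᵇ-injective φ {a} {b} inj = ⇔→≡ (mk⇔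
  (λ e → Equivalence.to T-≡ (≡⇒≡ᵇ a b (inj (≡ᵇ⇒≡ (φ a) (φ b) (Equivalence.from T-≡ e)))))
  (λ e → Equivalence.to T-≡ (≡⇒≡ᵇ (φ a) (φ b) (cong φ (≡ᵇ⇒≡ a b (Equivalence.from T-≡ e))))))

≢⇒≡ᵇ-false : ∀ {a b} → a ≢ b → (a ≡ᵇ b) ≡ false
≢⇒≡ᵇ-false {a} {b} a≢b = ¬-not (λ e → a≢b (≡ᵇ⇒≡ a b (Equivalence.from T-≡ e)))

lookup-ext : ∀ {A : Set} {k} {u v : Vec A k} → (∀ x → lookup u x ≡ lookup v x) → u ≡ v
lookup-ext {u = u} {v} u≗v = trans (sym (tabulate∘lookup u)) (trans (tabulate-cong u≗v) (tabulate∘lookup v))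

Vec-map-cong-local : ∀ {A B : Set} {k} {f g : A → B} (v : Vec A k) →
                     (∀ x → f (lookup v x) ≡ g (lookup v x)) → Vec.map f v ≡ Vec.map g v
Vec-map-cong-local v f≗g = lookup-ext λ x → trans (lookup-map x _ v) (trans (f≗g x) (sym (lookup-map x _ v)))

Vec-map-∘-local : ∀ {A B C D : Set} {k} (f : B → C) (g : A → B) (f′ : D → C) (g′ : A → D) (v : Vec A k) →
                  (∀ x → f (g (lookup v x)) ≡ f′ (g′ (lookup v x))) → Vec.map f (Vec.map g v) ≡ Vec.map f′ (Vec.map g′ v)
Vec-map-∘-local f g f′ g′ v fg≗f′g′ =
  trans (sym (Vec.map-∘ f g v)) (trans (Vec-map-cong-local v fg≗f′g′) (Vec.map-∘ f′ g′ v))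

→⇒T-not-∨ : ∀ {b c} → (T b → T c) → T (not b ∨ c)
→⇒T-not-∨ {true}  b⇒c = b⇒c _
→⇒T-not-∨ {false} _   = _

T-not-∨⇒→ : ∀ {b c} → T (not b ∨ c) → T b → T c
T-not-∨⇒→ {true} t _ = t

toList≡map-lookup : ∀ {A : Set} {k} (v : Vec A k) → Vec.toList v ≡ map (lookup v) (allFinL k)
toList≡map-lookup v = trans (go v) (sym (List.map-tabulate (λ x → x) (lookup v)))
  where
  go : ∀ {A : Set} {k} (v : Vec A k) → Vec.toList v ≡ List.tabulate (lookup v)
  go Vec.[]       = refl
  go (a Vec.∷ v) = cong (a ∷_) (go v)

-- Iteration and orbits

module _ {A : Set} (h : A → A) where

  iter-+ : ∀ a b x → iter (a + b) h x ≡ iter a h (iter b h x)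
  iter-+ zero    b x = refl
  iter-+ (suc a) b x = cong h (iter-+ a b x)

  iter-comm : ∀ a b x → iter a h (iter b h x) ≡ iter b h (iter a h x)
  iter-comm a b x = trans (sym (iter-+ a b x)) (trans (cong (λ k → iter k h x) (+-comm a b)) (iter-+ b a x))

  iter-sucʳ : ∀ a x → iter (suc a) h x ≡ iter a h (h x)
  iter-sucʳ a x = trans (cong (λ k → iter k h x) (+-comm 1 a)) (iter-+ a 1 x)

  iter-*-fixed : ∀ {b x} c → iter b h x ≡ x → iter (c * b) h x ≡ x
  iter-*-fixed {b} {x} zero    fixed = refl
  iter-*-fixed {b} {x} (suc c) fixed =
    trans (iter-+ b (c * b) x) (trans (cong (iter b h) (iter-*-fixed c fixed)) fixed)

  iter-%-fixed : ∀ {p x} .{{_ : NonZero p}} → iter p h x ≡ x → ∀ k → iter k h x ≡ iter (k % p) h x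
  iter-%-fixed {p} {x} fixed k = begin
    iter k h x                               ≡⟨ cong (λ j → iter j h x) (m≡m%n+[m/n]*n k p) ⟩
    iter (k % p + k / p * p) h x             ≡⟨ iter-+ (k % p) _ x ⟩
    iter (k % p) h (iter (k / p * p) h x)    ≡⟨ cong (iter (k % p) h) (iter-*-fixed (k / p) fixed) ⟩
    iter (k % p) h x                         ∎
    where open ≡-Reasoning

  iter-preserves : (Q : A → Set) → (∀ {x} → Q x → Q (h x)) → ∀ {x} k → Q x → Q (iter k h x)
  iter-preserves Q step zero    q = q
  iter-preserves Q step (suc k) q = step (iter-preserves Q step k q)

  module _ {a : A} {m : ℕ} (orbit : IsOrbitSize h a m) where

    private
      iter-m : iter m h a ≡ a
      iter-m = proj₁ (proj₂ orbit)

    -- j ∸ i is a period of iter i a, hence of a = iter (m ∸ i) (iter i a), against the minimality of m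
    iter-<-distinct : ∀ {i j} → i < j → j < m → iter i h a ≢ iter j h a
    iter-<-distinct {i} {j} i<j j<m eq =
      proj₂ (proj₂ orbit) (j ∸ i) (m<n⇒0<n∸m i<j) (≤-<-trans (m∸n≤m j i) j<m) d-fixes-a
      where
      d : ℕ
      d = j ∸ i
      y : A
      y = iter i h a
      d-fixes-y : iter d h y ≡ y
      d-fixes-y = trans (sym (iter-+ d i a)) (trans (cong (λ k → iter k h a) (m∸n+n≡m (<⇒≤ i<j))) (sym eq))
      a≡ : a ≡ iter (m ∸ i) h y
      a≡ = trans (sym iter-m)
        (trans (cong (λ k → iter k h a) (sym (m∸n+n≡m (<⇒≤ (<-trans i<j j<m))))) (iter-+ (m ∸ i) i a))
      d-fixes-a : iter d h a ≡ a
      d-fixes-a = begin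
        iter d h a                  ≡⟨ cong (iter d h) a≡ ⟩
        iter d h (iter (m ∸ i) h y) ≡⟨ iter-comm d (m ∸ i) y ⟩
        iter (m ∸ i) h (iter d h y) ≡⟨ cong (iter (m ∸ i) h) d-fixes-y ⟩
        iter (m ∸ i) h y            ≡⟨ a≡ ⟨
        a                           ∎
        where open ≡-Reasoning

    iter-injective : ∀ {i j} → i < m → j < m → iter i h a ≡ iter j h a → i ≡ j
    iter-injective {i} {j} i<m j<m eq with <-cmp i j
    ... | tri< i<j _ _ = ⊥-elim (iter-<-distinct i<j j<m eq)
    ... | tri≈ _ i≡j _ = i≡j
    ... | tri> _ _ j<i = ⊥-elim (iter-<-distinct j<i i<m (sym eq))

    orbitList-unique : Unique (orbitList h a m)
    orbitList-unique = Unique-map⁺-local (λ k → iter k h a)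
      (λ p q → iter-injective (∈-upTo⁻ p) (∈-upTo⁻ q)) (upTo⁺ m)

    iter-∈-orbitList : ∀ k → iter k h a ∈ orbitList h a m
    iter-∈-orbitList k with s≤s z≤n ← proj₁ orbit =
      subst (_∈ orbitList h a m) (sym (iter-%-fixed iter-m k)) (∈-map⁺ (λ j → iter j h a) (∈-upTo⁺ (m%n<n k m)))

  ∈-orbitList⁻ : ∀ {a m g} → g ∈ orbitList h a m → ∃ λ k → k < m × iter k h a ≡ g
  ∈-orbitList⁻ {a} g∈ with k , k∈ , refl ← ∈-map⁻ (λ j → iter j h a) g∈ = k , ∈-upTo⁻ k∈ , refl

Fin-injective⇒surjective : ∀ {m} (G : Fin m → Fin m) → Injective _≡_ _≡_ G → ∀ y → ∃ λ x → G x ≡ y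
Fin-injective⇒surjective {suc m} G inj y with any? (λ x → G x ≟ᶠ y)
... | yes hit = hit
... | no  miss = ⊥-elim (<-irrefl refl (injective⇒≤ {f = G′} G′-injective))
  where
  y≢G : ∀ x → y ≢ G x
  y≢G x eq = miss (x , sym eq)
  G′ : Fin (suc m) → Fin m
  G′ x = punchOut (y≢G x)
  G′-injective : Injective _≡_ _≡_ G′
  G′-injective {x} {z} eq = inj (punchOut-injective (y≢G x) (y≢G z) eq)

-- Decoding along the orbit makes the code injective on [0, m), hence onto Fin m.
orbitList-∋-decode : ∀ {A : Set} {h : A → A} {a m} → IsOrbitSize h a m →
                     (code : ℕ → Fin m) (decode : Fin m → A) → (∀ k → iter k h a ≡ decode (code k)) →
                     ∀ y → decode y ∈ orbitList h a m
orbitList-∋-decode {h = h} {a} {m} orbit code decode iter≡decode y =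
  decoded (Fin-injective⇒surjective (code ∘ toℕ) code-injective y)
  where
  code-injective : Injective _≡_ _≡_ (code ∘ toℕ)
  code-injective {x} {z} eq = toℕ-injective (iter-injective h orbit (toℕ<n x) (toℕ<n z)
    (trans (iter≡decode (toℕ x)) (trans (cong decode eq) (sym (iter≡decode (toℕ z))))))
  decoded : ∃ (λ x → code (toℕ x) ≡ y) → decode y ∈ orbitList h a m
  decoded (x , refl) =
    subst (_∈ orbitList h a m) (iter≡decode (toℕ x)) (∈-map⁺ (λ j → iter j h a) (∈-upTo⁺ (toℕ<n x)))

-- Binary words

trues : List Bool → ℕ
trues []          = 0
trues (true ∷ w)  = suc (trues w)
trues (false ∷ w) = trues w

-- nthTrue w j is the 1-based position of the j-th true in w; the box label 0 stays 0.
nthTrue : List Bool → ℕ → ℕ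
nthTrue w           zero          = zero
nthTrue []          (suc j)       = zero
nthTrue (true ∷ w)  (suc zero)    = 1
nthTrue (true ∷ w)  (suc (suc j)) = suc (nthTrue w (suc j))
nthTrue (false ∷ w) (suc j)       = suc (nthTrue w (suc j))

trues-++ : ∀ u v → trues (u ++ v) ≡ trues u + trues v
trues-++ []          v = refl
trues-++ (true ∷ u)  v = cong suc (trues-++ u v)
trues-++ (false ∷ u) v = trues-++ u v

trues-∷ʳ : ∀ w b → trues (w ++ [ b ]) ≡ trues (b ∷ w)
trues-∷ʳ w true  = trans (trues-++ w [ true ]) (+-comm (trues w) 1)
trues-∷ʳ w false = trans (trues-++ w [ false ]) (+-identityʳ (trues w))

trues-reverse : ∀ w → trues (reverse w) ≡ trues w
trues-reverse []      = refl
trues-reverse (b ∷ w) = begin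
  trues (reverse (b ∷ w))         ≡⟨ cong trues (unfold-reverse b w) ⟩
  trues (reverse w ++ [ b ])      ≡⟨ trues-∷ʳ (reverse w) b ⟩
  trues (b ∷ reverse w)           ≡⟨ trues-++ [ b ] (reverse w) ⟩
  trues [ b ] + trues (reverse w) ≡⟨ cong (trues [ b ] +_) (trues-reverse w) ⟩
  trues [ b ] + trues w           ≡⟨ trues-++ [ b ] w ⟨
  trues (b ∷ w)                   ∎
  where open ≡-Reasoning

trues-++-true : ∀ u v → suc (trues u) ≤ trues (u ++ true ∷ v)
trues-++-true []          v = s≤s z≤n
trues-++-true (true ∷ u)  v = s≤s (trues-++-true u v)
trues-++-true (false ∷ u) v = trues-++-true u v

nthTrue-suc-positive : ∀ w {j} → suc j ≤ trues w → 0 < nthTrue w (suc j)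
nthTrue-suc-positive (true ∷ w) {zero}  _ = s≤s z≤n
nthTrue-suc-positive (true ∷ w) {suc j} _ = s≤s z≤n
nthTrue-suc-positive (false ∷ w)        _ = s≤s z≤n

nthTrue-suc≢0 : ∀ w {j} → suc j ≤ trues w → nthTrue w (suc j) ≢ 0
nthTrue-suc≢0 w j< = n>0⇒n≢0 (nthTrue-suc-positive w j<)

nthTrue-injective : ∀ w {i j} → i ≤ trues w → j ≤ trues w → nthTrue w i ≡ nthTrue w j → i ≡ j
nthTrue-injective w           {zero}        {zero}        _  _  _  = refl
nthTrue-injective w           {zero}        {suc j}       _  j≤ eq = ⊥-elim (nthTrue-suc≢0 w j≤ (sym eq))
nthTrue-injective w           {suc i}       {zero}        i≤ _  eq = ⊥-elim (nthTrue-suc≢0 w i≤ eq)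
nthTrue-injective (true ∷ w)  {suc zero}    {suc zero}    _  _  _  = refl
nthTrue-injective (true ∷ w)  {suc zero}    {suc (suc j)} _  j≤ eq =
  ⊥-elim (nthTrue-suc≢0 w (s≤s⁻¹ j≤) (sym (suc-injective eq)))
nthTrue-injective (true ∷ w)  {suc (suc i)} {suc zero}    i≤ _  eq =
  ⊥-elim (nthTrue-suc≢0 w (s≤s⁻¹ i≤) (suc-injective eq))
nthTrue-injective (true ∷ w)  {suc (suc i)} {suc (suc j)} i≤ j≤ eq =
  cong suc (nthTrue-injective w (s≤s⁻¹ i≤) (s≤s⁻¹ j≤) (suc-injective eq))
nthTrue-injective (false ∷ w) {suc i}       {suc j}       i≤ j≤ eq =
  nthTrue-injective w i≤ j≤ (suc-injective eq)

nthTrue-++ˡ : ∀ u v {j} → j ≤ trues u → nthTrue (u ++ v) j ≡ nthTrue u j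
nthTrue-++ˡ u           v {zero}        _  = refl
nthTrue-++ˡ (true ∷ u)  v {suc zero}    _  = refl
nthTrue-++ˡ (true ∷ u)  v {suc (suc j)} j≤ = cong suc (nthTrue-++ˡ u v (s≤s⁻¹ j≤))
nthTrue-++ˡ (false ∷ u) v {suc j}       j≤ = cong suc (nthTrue-++ˡ u v j≤)

nthTrue-++-true : ∀ u v → nthTrue (u ++ true ∷ v) (suc (trues u)) ≡ suc (length u)
nthTrue-++-true []          v = refl
nthTrue-++-true (true ∷ u)  v = cong suc (nthTrue-++-true u v)
nthTrue-++-true (false ∷ u) v = cong suc (nthTrue-++-true u v)

nthTrue-++-false : ∀ u v {j} → j ≤ trues (u ++ false ∷ v) → nthTrue (u ++ false ∷ v) j ≢ suc (length u)
nthTrue-++-false u           v {zero}        _  ()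
nthTrue-++-false []          v {suc j}       j≤ eq = nthTrue-suc≢0 v j≤ (suc-injective eq)
nthTrue-++-false (true ∷ u)  v {suc zero}    _  ()
nthTrue-++-false (true ∷ u)  v {suc (suc j)} j≤ eq = nthTrue-++-false u v (s≤s⁻¹ j≤) (suc-injective eq)
nthTrue-++-false (false ∷ u) v {suc j}       j≤ eq = nthTrue-++-false u v j≤ (suc-injective eq)

nthTrue-reverse-∷ : ∀ b w {j} → j ≤ trues w → nthTrue (reverse (b ∷ w)) j ≡ nthTrue (reverse w) j
nthTrue-reverse-∷ b w {j} j≤ = trans (cong (λ v → nthTrue v j) (unfold-reverse b w))
  (nthTrue-++ˡ (reverse w) [ b ] (subst (j ≤_) (sym (trues-reverse w)) j≤))

nthTrue-reverse : ∀ w {j} → suc j ≤ trues w →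
                  nthTrue (reverse w) (trues w ∸ j) ≡ suc (length w) ∸ nthTrue w (suc j)
nthTrue-reverse (true ∷ w) {zero} _ = begin
  nthTrue (reverse (true ∷ w)) (suc (trues w))
    ≡⟨ cong₂ nthTrue (unfold-reverse true w) (cong suc (sym (trues-reverse w))) ⟩
  nthTrue (reverse w ++ [ true ]) (suc (trues (reverse w))) ≡⟨ nthTrue-++-true (reverse w) [] ⟩
  suc (length (reverse w))                                  ≡⟨ cong suc (length-reverse w) ⟩
  suc (length w)                                            ∎
  where open ≡-Reasoning
nthTrue-reverse (true ∷ w) {suc j} j< =
  trans (nthTrue-reverse-∷ true w (m∸n≤m (trues w) j)) (nthTrue-reverse w (s≤s⁻¹ j<))
nthTrue-reverse (false ∷ w) {j} j< =
  trans (nthTrue-reverse-∷ false w (m∸n≤m (trues w) j)) (nthTrue-reverse w j<)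

length-rot : ∀ w → length (rot w) ≡ length w
length-rot []      = refl
length-rot (b ∷ w) = trans (length-++ w) (+-comm (length w) 1)

trues-rot : ∀ w → trues (rot w) ≡ trues w
trues-rot []      = refl
trues-rot (b ∷ w) = trues-∷ʳ w b

length-iter-rot : ∀ k w → length (iter k rot w) ≡ length w
length-iter-rot zero    w = refl
length-iter-rot (suc k) w = trans (length-rot (iter k rot w)) (length-iter-rot k w)

trues-iter-rot : ∀ k w → trues (iter k rot w) ≡ trues w
trues-iter-rot zero    w = refl
trues-iter-rot (suc k) w = trans (trues-rot (iter k rot w)) (trues-iter-rot k w)

iter-rot-++ : ∀ u v → iter (length u) rot (u ++ v) ≡ v ++ u
iter-rot-++ []      v = sym (++-identityʳ v)
iter-rot-++ (b ∷ u) v = begin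
  iter (suc (length u)) rot (b ∷ u ++ v) ≡⟨ iter-sucʳ rot (length u) (b ∷ u ++ v) ⟩
  iter (length u) rot ((u ++ v) ++ [ b ]) ≡⟨ cong (iter (length u) rot) (++-assoc u v [ b ]) ⟩
  iter (length u) rot (u ++ v ++ [ b ])   ≡⟨ iter-rot-++ u (v ++ [ b ]) ⟩
  (v ++ [ b ]) ++ u                       ≡⟨ ++-assoc v [ b ] u ⟩
  v ++ b ∷ u                              ∎
  where open ≡-Reasoning

iter-rot-length : ∀ w → iter (length w) rot w ≡ w
iter-rot-length w = trans (cong (iter (length w) rot) (sym (++-identityʳ w))) (iter-rot-++ w [])

iter-rot-[] : ∀ k → iter k rot [] ≡ []
iter-rot-[] zero    = refl
iter-rot-[] (suc k) = cong rot (iter-rot-[] k)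

iter-rot-inverse : ∀ k w → ∃ λ j → iter j rot (iter k rot w) ≡ w
iter-rot-inverse k []      = 0 , iter-rot-[] k
iter-rot-inverse k (b ∷ w) = length w * k , (begin
  iter (length w * k) rot (iter k rot (b ∷ w)) ≡⟨ iter-+ rot (length w * k) k (b ∷ w) ⟨
  iter (length w * k + k) rot (b ∷ w)          ≡⟨ cong (λ t → iter t rot (b ∷ w)) (+-comm (length w * k) k) ⟩
  iter (suc (length w) * k) rot (b ∷ w)        ≡⟨ cong (λ t → iter t rot (b ∷ w)) (*-comm (suc (length w)) k) ⟩
  iter (k * length (b ∷ w)) rot (b ∷ w)        ≡⟨ iter-*-fixed rot k (iter-rot-length (b ∷ w)) ⟩
  b ∷ w                                        ∎)
  where open ≡-Reasoning

rot-reverse-rot : ∀ w → rot (reverse (rot w)) ≡ reverse w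
rot-reverse-rot []      = refl
rot-reverse-rot (b ∷ w) = trans (cong rot (reverse-++ w [ b ])) (sym (unfold-reverse b w))

iter-rot-reverse-iter-rot : ∀ k w → iter k rot (reverse (iter k rot w)) ≡ reverse w
iter-rot-reverse-iter-rot zero    w = refl
iter-rot-reverse-iter-rot (suc k) w = begin
  iter (suc k) rot (reverse (rot (iter k rot w))) ≡⟨ iter-sucʳ rot k _ ⟩
  iter k rot (rot (reverse (rot (iter k rot w)))) ≡⟨ cong (iter k rot) (rot-reverse-rot (iter k rot w)) ⟩
  iter k rot (reverse (iter k rot w))             ≡⟨ iter-rot-reverse-iter-rot k w ⟩
  reverse w                                       ∎
  where open ≡-Reasoning

-- reverse ∘ ρᵏ = ρ⁻ᵏ ∘ reverse, and reverse w is itself a rotation of w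
reverse-iter-rot : ∀ {i w} → iter i rot w ≡ reverse w → ∀ k → ∃ λ j → reverse (iter k rot w) ≡ iter j rot w
reverse-iter-rot {i} {w} ρⁱw≡rev k with j , ρʲρᵏ≡id ← iter-rot-inverse k (reverse (iter k rot w)) =
  j + i , (begin
    reverse (iter k rot w)                                ≡⟨ ρʲρᵏ≡id ⟨
    iter j rot (iter k rot (reverse (iter k rot w)))      ≡⟨ cong (iter j rot) (iter-rot-reverse-iter-rot k w) ⟩
    iter j rot (reverse w)                                ≡⟨ cong (iter j rot) ρⁱw≡rev ⟨
    iter j rot (iter i rot w)                             ≡⟨ iter-+ rot j i w ⟨
    iter (j + i) rot w                                    ∎)
  where open ≡-Reasoning

labelsFrom : ℕ → ℕ → List ℕ
labelsFrom s zero    = []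
labelsFrom s (suc k) = s ∷ labelsFrom (suc s) k

map-+-upTo : ∀ s k → map (s +_) (upTo k) ≡ labelsFrom s k
map-+-upTo s k = trans (map-upTo (s +_) k) (applyUpTo-labelsFrom s k (λ _ → refl))
  where
  applyUpTo-labelsFrom : ∀ s k {f} → (∀ i → f i ≡ s + i) → applyUpTo f k ≡ labelsFrom s k
  applyUpTo-labelsFrom s zero    f≗ = refl
  applyUpTo-labelsFrom s (suc k) f≗ = cong₂ _∷_ (trans (f≗ 0) (+-identityʳ s))
    (applyUpTo-labelsFrom (suc s) k (λ i → trans (f≗ (suc i)) (+-suc s i)))

labelsFrom-+ : ∀ s a b → labelsFrom s (a + b) ≡ labelsFrom s a ++ labelsFrom (s + a) b
labelsFrom-+ s zero    b = cong (λ t → labelsFrom t b) (sym (+-identityʳ s))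
labelsFrom-+ s (suc a) b =
  cong (s ∷_) (trans (labelsFrom-+ (suc s) a b) (cong (λ t → labelsFrom (suc s) a ++ labelsFrom t b) (sym (+-suc s a))))

labelsFrom-bounds : ∀ s k → All (λ j → s ≤ j × j < s + k) (labelsFrom s k)
labelsFrom-bounds s zero    = []
labelsFrom-bounds s (suc k) =
  (≤-refl , subst (s <_) (sym (+-suc s k)) (s≤s (m≤m+n s k)))
  ∷ All.map (λ { (s<j , j<) → <⇒≤ s<j , <-≤-trans j< (≤-reflexive (sym (+-suc s k))) }) (labelsFrom-bounds (suc s) k)

promotionLabels-bounds : ∀ r → All (λ j → 2 ≤ j × j ≤ r) (labelsFrom 2 (r ∸ 1))
promotionLabels-bounds zero    = []
promotionLabels-bounds (suc r) = All.map (λ { (2≤j , j<) → 2≤j , s≤s⁻¹ j< }) (labelsFrom-bounds 2 r)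

leadingTrue : List Bool → ℕ
leadingTrue (true ∷ _) = 1
leadingTrue _          = 0

-- Promotion

InRange : ∀ {n} → ℕ → Labeling n → Set
InRange r g = ∀ x → 1 ≤ lookup g x × lookup g x ≤ r

-- the entries while sliding: the labels 1 have become boxes 0
BoxOrLabel : ℕ → ℕ → Set
BoxOrLabel r a = a ≡ 0 ⊎ (2 ≤ a × a ≤ r)

BoxOrLabel⇒≤ : ∀ {r a} → BoxOrLabel r a → a ≤ r
BoxOrLabel⇒≤ (inj₁ refl)      = z≤n
BoxOrLabel⇒≤ (inj₂ (_ , a≤r)) = a≤r

boxOnes : ℕ → ℕ
boxOnes a = if a ≡ᵇ 1 then 0 else a

unbox : ℕ → ℕ → ℕ
unbox q a = if a ≡ᵇ 0 then q else a ∸ 1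

boxOnes-≥2 : ∀ {a} → 2 ≤ a → boxOnes a ≡ a
boxOnes-≥2 (s≤s (s≤s _)) = refl

boxOnes-BoxOrLabel : ∀ {r a} → 1 ≤ a × a ≤ r → BoxOrLabel r (boxOnes a)
boxOnes-BoxOrLabel {a = suc zero}    _         = inj₁ refl
boxOnes-BoxOrLabel {a = suc (suc a)} (_ , a≤r) = inj₂ (s≤s (s≤s z≤n) , a≤r)

boxOnes-InRange : ∀ {n r} {g : Labeling n} → InRange r g → ∀ y → BoxOrLabel r (lookup (Vec.map boxOnes g) y)
boxOnes-InRange {r = r} {g} g∈ y = subst (BoxOrLabel r) (sym (lookup-map y boxOnes g)) (boxOnes-BoxOrLabel (g∈ y))

module _ {n : ℕ} (P : SelfDualPoset n) where

  slides : Labeling n → List ℕ → Labeling n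
  slides = foldl (λ g i → slideStep P i g)

  Pro-slides : ∀ q f → Pro P q f ≡ Vec.map (unbox q) (slides (Vec.map boxOnes f) (labelsFrom 2 (q ∸ 1)))
  Pro-slides q f = cong (λ js → Vec.map (unbox q) (slides (Vec.map boxOnes f) js)) (map-+-upTo 2 (q ∸ 1))

  guard : Bool → (Fin n → Bool) → (Fin n → ℕ) → ℕ → Bool
  guard b c v j = b ∧ any (λ y → c y ∧ (v y ≡ᵇ j)) (allFinL n)

  fillsᵇ : ℕ → Labeling n → Fin n → Bool
  fillsᵇ j h x = guard (lookup h x ≡ᵇ 0) (coverᵇ P x) (lookup h) j

  emptiesᵇ : ℕ → Labeling n → Fin n → Bool
  emptiesᵇ j h x = guard (lookup h x ≡ᵇ j) (λ z → coverᵇ P z x) (lookup h) 0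

  lookup-slideStep : ∀ j h x →
    lookup (slideStep P j h) x ≡ (if fillsᵇ j h x then j else if emptiesᵇ j h x then 0 else lookup h x)
  lookup-slideStep j h x =
    lookup∘tabulate (λ x → if fillsᵇ j h x then j else if emptiesᵇ j h x then 0 else lookup h x) x

  slideStep-preserves : (Q : ℕ → Set) → Q 0 → ∀ j h → Q j → (∀ y → Q (lookup h y)) →
                        ∀ x → Q (lookup (slideStep P j h) x)
  slideStep-preserves Q q0 j h qj qh x rewrite lookup-slideStep j h x
    with fillsᵇ j h x | emptiesᵇ j h x
  ... | true  | _     = qj
  ... | false | true  = q0
  ... | false | false = qh x

  slides-preserves : (Q : ℕ → Set) → Q 0 → ∀ {js h} → All Q js → (∀ y → Q (lookup h y)) →
                     ∀ x → Q (lookup (slides h js) x)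
  slides-preserves Q q0 []         qh = qh
  slides-preserves Q q0 {j ∷ _} {h} (qj ∷ qjs) qh =
    slides-preserves Q q0 qjs (slideStep-preserves Q q0 j h qj qh)

  guard-absent : ∀ b c {v : Fin n → ℕ} {j} → (∀ y → v y ≢ j) → guard b c v j ≡ false
  guard-absent b c v≢j =
    trans (cong (b ∧_) (any-false (λ y → trans (cong (c y ∧_) (≢⇒≡ᵇ-false (v≢j y))) (∧-zeroʳ (c y))) (allFinL n)))
          (∧-zeroʳ b)

  slideStep-unchanged : ∀ {j h} → (∀ x → fillsᵇ j h x ≡ false) → (∀ x → emptiesᵇ j h x ≡ false) →
                        slideStep P j h ≡ h
  slideStep-unchanged {j} {h} no-fill no-empty = lookup-ext λ x →
    trans (lookup-slideStep j h x)
          (cong₂ (λ A B → if A then j else if B then 0 else lookup h x) (no-fill x) (no-empty x))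

  slideStep-absent : ∀ j h → (∀ y → lookup h y ≢ j) → slideStep P j h ≡ h
  slideStep-absent j h h≢j = slideStep-unchanged
    (λ x → guard-absent (lookup h x ≡ᵇ 0) (coverᵇ P x) h≢j)
    (λ x → cong (λ b → guard b (λ z → coverᵇ P z x) (lookup h) 0) (≢⇒≡ᵇ-false (h≢j x)))

  slides-boxless : ∀ {h} → (∀ y → lookup h y ≢ 0) → ∀ js → slides h js ≡ h
  slides-boxless {h} h≢0 []       = refl
  slides-boxless {h} h≢0 (j ∷ js) = trans (cong (λ g → slides g js) boxless) (slides-boxless h≢0 js)
    where
    boxless : slideStep P j h ≡ h
    boxless = slideStep-unchanged
      (λ x → cong (λ b → guard b (coverᵇ P x) (lookup h) j) (≢⇒≡ᵇ-false (h≢0 x)))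
      (λ x → guard-absent (lookup h x ≡ᵇ j) (λ z → coverᵇ P z x) h≢0)

  guard-cong : ∀ {b b′} c (v v′ : Fin n → ℕ) j j′ → b ≡ b′ → (∀ y → (v y ≡ᵇ j) ≡ (v′ y ≡ᵇ j′)) →
               guard b c v j ≡ guard b′ c v′ j′
  guard-cong c v v′ j j′ b≡b′ tests≡ = cong₂ _∧_ b≡b′ (any-cong (λ y → cong (c y ∧_) (tests≡ y)) (allFinL n))

  -- sliding only tests entries for being 0 or j, and an injective φ with φ 0 ≡ 0 preserves these tests
  slideStep-relabel : ∀ {φ : ℕ → ℕ} {r} j h → φ 0 ≡ 0 →
                      (∀ {a b} → a ≤ r → b ≤ r → φ a ≡ φ b → a ≡ b) → j ≤ r → (∀ y → lookup h y ≤ r) →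
                      slideStep P (φ j) (Vec.map φ h) ≡ Vec.map φ (slideStep P j h)
  slideStep-relabel {φ} {r} j h φ0≡0 inj j≤r h≤r = lookup-ext λ x → begin
    lookup (slideStep P (φ j) φh) x
      ≡⟨ lookup-slideStep (φ j) φh x ⟩
    (if fillsᵇ (φ j) φh x then φ j else if emptiesᵇ (φ j) φh x then 0 else lookup φh x)
      ≡⟨ cong₂ (λ A B → if A then φ j else if B then 0 else lookup φh x)
           (guard-cong (coverᵇ P x) (lookup φh) (lookup h) (φ j) j (test-0 x) test-j)
           (guard-cong (λ z → coverᵇ P z x) (lookup φh) (lookup h) 0 0 (test-j x) test-0) ⟩
    (if fillsᵇ j h x then φ j else if emptiesᵇ j h x then 0 else lookup φh x)
      ≡⟨ cong (λ v → if fillsᵇ j h x then φ j else if emptiesᵇ j h x then 0 else v) (lookup-map x φ h) ⟩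
    (if fillsᵇ j h x then φ j else if emptiesᵇ j h x then 0 else φ (lookup h x))
      ≡⟨ if-relabel (fillsᵇ j h x) (emptiesᵇ j h x) ⟩
    φ (if fillsᵇ j h x then j else if emptiesᵇ j h x then 0 else lookup h x)
      ≡⟨ cong φ (lookup-slideStep j h x) ⟨
    φ (lookup (slideStep P j h) x)
      ≡⟨ lookup-map x φ (slideStep P j h) ⟨
    lookup (Vec.map φ (slideStep P j h)) x ∎
    where
    open ≡-Reasoning
    φh : Labeling n
    φh = Vec.map φ h
    test-j : ∀ y → (lookup φh y ≡ᵇ φ j) ≡ (lookup h y ≡ᵇ j)
    test-j y = trans (cong (_≡ᵇ φ j) (lookup-map y φ h)) (≡ᵇ-injective φ (inj (h≤r y) j≤r))
    test-0 : ∀ y → (lookup φh y ≡ᵇ 0) ≡ (lookup h y ≡ᵇ 0)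
    test-0 y = trans (cong₂ _≡ᵇ_ (lookup-map y φ h) (sym φ0≡0)) (≡ᵇ-injective φ (inj (h≤r y) z≤n))
    if-relabel : ∀ A B {v} → (if A then φ j else if B then 0 else φ v) ≡ φ (if A then j else if B then 0 else v)
    if-relabel true  _     = refl
    if-relabel false true  = sym φ0≡0
    if-relabel false false = refl

  slides-BoxOrLabel : ∀ {r} {g : Labeling n} → InRange r g →
                      ∀ y → BoxOrLabel r (lookup (slides (Vec.map boxOnes g) (labelsFrom 2 (r ∸ 1))) y)
  slides-BoxOrLabel {r} {g} g∈ = slides-preserves (BoxOrLabel r) (inj₁ refl)
    (All.map inj₂ (promotionLabels-bounds r)) (boxOnes-InRange {g = g} g∈)

  Pro-InRange : ∀ {r} {g : Labeling n} → InRange r g → InRange r (Pro P r g)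
  Pro-InRange {r} {g} g∈ x =
    subst (λ v → 1 ≤ v × v ≤ r) (sym (trans (cong (λ f → lookup f x) (Pro-slides r g)) (lookup-map x (unbox r) h)))
      (unbox-InRange (slides-BoxOrLabel g∈ x))
    where
    h : Labeling n
    h = slides (Vec.map boxOnes g) (labelsFrom 2 (r ∸ 1))
    unbox-InRange : ∀ {a} → BoxOrLabel r a → 1 ≤ unbox r a × unbox r a ≤ r
    unbox-InRange (inj₁ refl)                           = ≤-trans (proj₁ (g∈ x)) (proj₂ (g∈ x)) , ≤-refl
    unbox-InRange {suc zero}    (inj₂ (s≤s () , _))
    unbox-InRange {suc (suc a)} (inj₂ (_ , a≤r)) = s≤s z≤n , ≤-trans (n≤1+n (suc a)) a≤r


-- Inflation

-- for w = Con q f this undoes the deflation of f (inflate-Con-deflate)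
inflate : ∀ {n} → List Bool → Labeling n → Labeling n
inflate w = Vec.map (nthTrue w)

boxOnes-nthTrue-true : ∀ w {a} → 1 ≤ a × a ≤ suc (trues w) →
                       boxOnes (nthTrue (true ∷ w) a) ≡ nthTrue (true ∷ w) (boxOnes a)
boxOnes-nthTrue-true w {suc zero}    _        = refl
boxOnes-nthTrue-true w {suc (suc a)} (_ , a≤) = boxOnes-≥2 (s≤s (nthTrue-suc-positive w (s≤s⁻¹ a≤)))

unbox-nthTrue-true : ∀ w {a} → BoxOrLabel (suc (trues w)) a →
                     unbox (suc (length w)) (nthTrue (true ∷ w) a) ≡ nthTrue (w ++ [ true ]) (unbox (suc (trues w)) a)
unbox-nthTrue-true w (inj₁ refl)                    = sym (nthTrue-++-true w [])
unbox-nthTrue-true w {suc zero}    (inj₂ (s≤s () , _))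
unbox-nthTrue-true w {suc (suc a)} (inj₂ (_ , a≤)) = sym (nthTrue-++ˡ w [ true ] (s≤s⁻¹ a≤))

nthTrue-false-≥2 : ∀ w {a} → 1 ≤ a × a ≤ trues w → 2 ≤ nthTrue (false ∷ w) a
nthTrue-false-≥2 w {suc a} (_ , a≤) = s≤s (nthTrue-suc-positive w a≤)

unbox-nthTrue-false : ∀ w {q a} → 1 ≤ a × a ≤ trues w → unbox q (nthTrue (false ∷ w) a) ≡ nthTrue (w ++ [ false ]) a
unbox-nthTrue-false w {a = suc a} (_ , a≤) = sym (nthTrue-++ˡ w [ false ] a≤)

module _ {n : ℕ} (P : SelfDualPoset n) where

  slideStep-inflate-true : ∀ u v (h : Labeling n) → (∀ y → lookup h y ≤ trues (u ++ true ∷ v)) →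
    slideStep P (suc (length u)) (inflate (u ++ true ∷ v) h) ≡ inflate (u ++ true ∷ v) (slideStep P (suc (trues u)) h)
  slideStep-inflate-true u v h h≤ =
    trans (cong (λ j → slideStep P j (inflate w h)) (sym (nthTrue-++-true u v)))
          (slideStep-relabel P (suc (trues u)) h refl (nthTrue-injective w) (trues-++-true u v) h≤)
    where
    w : List Bool
    w = u ++ true ∷ v

  slideStep-inflate-false : ∀ u v (h : Labeling n) → (∀ y → lookup h y ≤ trues (u ++ false ∷ v)) →
    slideStep P (suc (length u)) (inflate (u ++ false ∷ v) h) ≡ inflate (u ++ false ∷ v) h
  slideStep-inflate-false u v h h≤ = slideStep-absent P (suc (length u)) (inflate (u ++ false ∷ v) h) λ y eq →
    nthTrue-++-false u v (h≤ y) (trans (sym (lookup-map y _ h)) eq)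

  -- labels at the false positions of w do not occur in inflate w h; the others are inflated labels of h
  slides-inflate : ∀ {w} u v {a t} {h : Labeling n} → u ++ v ≡ w → length u ≡ a → trues u ≡ t →
    (∀ y → lookup h y ≤ trues w) →
    slides P (inflate w h) (labelsFrom (suc a) (length v)) ≡ inflate w (slides P h (labelsFrom (suc t) (trues v)))
  slides-inflate u []          refl refl refl h≤ = refl
  slides-inflate u (true ∷ v)  {h = h} refl refl refl h≤ = begin
    slides P (slideStep P (suc (length u)) (inflate w h)) (labelsFrom (suc (suc (length u))) (length v))
      ≡⟨ cong (λ g → slides P g (labelsFrom (suc (suc (length u))) (length v))) (slideStep-inflate-true u v h h≤) ⟩
    slides P (inflate w h′) (labelsFrom (suc (suc (length u))) (length v))
      ≡⟨ slides-inflate (u ++ [ true ]) v (++-assoc u [ true ] v) (length-rot (true ∷ u)) (trues-∷ʳ u true) h′≤ ⟩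
    inflate w (slides P h′ (labelsFrom (suc (suc (trues u))) (trues v))) ∎
    where
    open ≡-Reasoning
    w : List Bool
    w = u ++ true ∷ v
    h′ : Labeling n
    h′ = slideStep P (suc (trues u)) h
    h′≤ : ∀ y → lookup h′ y ≤ trues w
    h′≤ = slideStep-preserves P (_≤ trues w) z≤n (suc (trues u)) h (trues-++-true u v) h≤
  slides-inflate u (false ∷ v) {h = h} refl refl refl h≤ =
    trans (cong (λ g → slides P g (labelsFrom (suc (suc (length u))) (length v))) (slideStep-inflate-false u v h h≤))
          (slides-inflate (u ++ [ false ]) v (++-assoc u [ false ] v) (length-rot (false ∷ u)) (trues-∷ʳ u false) h≤)

  Pro-inflate-true : ∀ w (g : Labeling n) → InRange (suc (trues w)) g →
    Pro P (suc (length w)) (inflate (true ∷ w) g) ≡ inflate (w ++ [ true ]) (Pro P (suc (trues w)) g)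
  Pro-inflate-true w g g∈ = begin
    Pro P q (inflate (true ∷ w) g)
      ≡⟨ Pro-slides P q _ ⟩
    Vec.map (unbox q) (slides P (Vec.map boxOnes (Vec.map φ g)) L)
      ≡⟨ cong (λ g′ → Vec.map (unbox q) (slides P g′ L))
              (Vec-map-∘-local boxOnes φ φ boxOnes g (boxOnes-nthTrue-true w ∘ g∈)) ⟩
    Vec.map (unbox q) (slides P (inflate (true ∷ w) (Vec.map boxOnes g)) L)
      ≡⟨ cong (Vec.map (unbox q))
              (slides-inflate [ true ] w refl refl refl (BoxOrLabel⇒≤ ∘ boxOnes-InRange {g = g} g∈)) ⟩
    Vec.map (unbox q) (Vec.map φ h)
      ≡⟨ Vec-map-∘-local (unbox q) φ (nthTrue (w ++ [ true ])) (unbox r) h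
           (unbox-nthTrue-true w ∘ slides-BoxOrLabel P {g = g} g∈) ⟩
    inflate (w ++ [ true ]) (Vec.map (unbox r) h)
      ≡⟨ cong (inflate (w ++ [ true ])) (Pro-slides P r g) ⟨
    inflate (w ++ [ true ]) (Pro P r g) ∎
    where
    open ≡-Reasoning
    q : ℕ
    q = suc (length w)
    r : ℕ
    r = suc (trues w)
    φ : ℕ → ℕ
    φ = nthTrue (true ∷ w)
    L : List ℕ
    L = labelsFrom 2 (length w)
    h : Labeling n
    h = slides P (Vec.map boxOnes g) (labelsFrom 2 (trues w))

  Pro-inflate-false : ∀ w (g : Labeling n) → InRange (trues w) g →
    Pro P (suc (length w)) (inflate (false ∷ w) g) ≡ inflate (w ++ [ false ]) g
  Pro-inflate-false w g g∈ = begin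
    Pro P q h                                    ≡⟨ Pro-slides P q h ⟩
    Vec.map (unbox q) (slides P (Vec.map boxOnes h) L) ≡⟨ cong (λ g′ → Vec.map (unbox q) (slides P g′ L)) boxOnes-h ⟩
    Vec.map (unbox q) (slides P h L)             ≡⟨ cong (Vec.map (unbox q)) (slides-boxless P (λ y → m<n⇒n≢0 (h≥2 y)) L) ⟩
    Vec.map (unbox q) (Vec.map φ g)              ≡⟨ Vec.map-∘ (unbox q) φ g ⟨
    Vec.map (unbox q ∘ φ) g                      ≡⟨ Vec-map-cong-local g (unbox-nthTrue-false w ∘ g∈) ⟩
    inflate (w ++ [ false ]) g                   ∎
    where
    open ≡-Reasoning
    q : ℕ
    q = suc (length w)
    φ : ℕ → ℕ
    φ = nthTrue (false ∷ w)
    L : List ℕ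
    L = labelsFrom 2 (length w)
    h : Labeling n
    h = inflate (false ∷ w) g
    h≥2 : ∀ y → 2 ≤ lookup h y
    h≥2 y = subst (2 ≤_) (sym (lookup-map y φ g)) (nthTrue-false-≥2 w (g∈ y))
    boxOnes-h : Vec.map boxOnes h ≡ h
    boxOnes-h = trans (Vec-map-cong-local {g = λ a → a} h (boxOnes-≥2 ∘ h≥2)) (Vec.map-id h)

  Pro-inflate : ∀ w {q r} (g : Labeling n) → length w ≡ q → trues w ≡ r → InRange r g →
    Pro P q (inflate w g) ≡ inflate (rot w) (iter (leadingTrue w) (Pro P r) g)
  Pro-inflate []          g refl refl g∈ = lookup-ext λ x → contradiction (≤-trans (proj₁ (g∈ x)) (proj₂ (g∈ x))) λ ()
  Pro-inflate (true ∷ w)  g refl refl g∈ = Pro-inflate-true w g g∈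
  Pro-inflate (false ∷ w) g refl refl g∈ = Pro-inflate-false w g g∈

  iter-Pro-inflate : ∀ c {g : Labeling n} → InRange (trues c) g → ∀ k →
    ∃ λ N → iter k (Pro P (length c)) (inflate c g) ≡ inflate (iter k rot c) (iter N (Pro P (trues c)) g)
  iter-Pro-inflate c g∈ zero    = 0 , refl
  iter-Pro-inflate c {g} g∈ (suc k) with N , eq ← iter-Pro-inflate c g∈ k =
    leadingTrue cₖ + N , (begin
      Pro P (length c) (iter k (Pro P (length c)) (inflate c g)) ≡⟨ cong (Pro P (length c)) eq ⟩
      Pro P (length c) (inflate cₖ gₙ)
        ≡⟨ Pro-inflate cₖ gₙ (length-iter-rot k c) (trues-iter-rot k c)
             (iter-preserves (Pro P (trues c)) (InRange (trues c)) (Pro-InRange P) N g∈) ⟩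
      inflate (rot cₖ) (iter (leadingTrue cₖ) (Pro P (trues c)) gₙ)
        ≡⟨ cong (inflate (rot cₖ)) (iter-+ (Pro P (trues c)) (leadingTrue cₖ) N g) ⟨
      inflate (rot cₖ) (iter (leadingTrue cₖ + N) (Pro P (trues c)) g) ∎)
    where
    open ≡-Reasoning
    cₖ : List Bool
    cₖ = iter k rot c
    gₙ : Labeling n
    gₙ = iter N (Pro P (trues c)) g

  swap-inflate : ∀ w {q r} (g : Labeling n) → length w ≡ q → trues w ≡ r → InRange r g →
    swap P q (inflate w g) ≡ inflate (reverse w) (swap P r g)
  swap-inflate w g refl refl g∈ = lookup-ext λ x → begin
    lookup (swap P (length w) (inflate w g)) x                  ≡⟨ lookup∘tabulate _ x ⟩
    suc (length w) ∸ lookup (inflate w g) (κ x)                 ≡⟨ cong (suc (length w) ∸_) (lookup-map (κ x) _ g) ⟩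
    suc (length w) ∸ nthTrue w (lookup g (κ x))                 ≡⟨ pointwise (g∈ (κ x)) ⟩
    nthTrue (reverse w) (suc (trues w) ∸ lookup g (κ x))        ≡⟨ cong (nthTrue (reverse w)) (lookup∘tabulate _ x) ⟨
    nthTrue (reverse w) (lookup (swap P (trues w) g) x)         ≡⟨ lookup-map x _ (swap P (trues w) g) ⟨
    lookup (inflate (reverse w) (swap P (trues w) g)) x         ∎
    where
    open ≡-Reasoning
    open SelfDualPoset P using (κ)
    pointwise : ∀ {a} → 1 ≤ a × a ≤ trues w → suc (length w) ∸ nthTrue w a ≡ nthTrue (reverse w) (suc (trues w) ∸ a)
    pointwise {suc a} (_ , a≤) = sym (nthTrue-reverse w a≤)

-- Deflation

length-filter-trues : ∀ (u : ℕ → Bool) xs → length (filter (λ i → u i Bool.≟ true) xs) ≡ trues (map u xs)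
length-filter-trues u []       = refl
length-filter-trues u (x ∷ xs) with u x
... | true  = cong suc (length-filter-trues u xs)
... | false = length-filter-trues u xs

module _ {n : ℕ} (f : Labeling n) where

  private
    u : ℕ → Bool
    u = usedᵇ f

  length-Con : ∀ q → length (Con q f) ≡ q
  length-Con q = trans (length-map u (oneTo q)) (trans (length-map suc (upTo q)) (length-upTo q))

  usedCount≡trues-Con : ∀ q → usedCount q f ≡ trues (Con q f)
  usedCount≡trues-Con q = length-filter-trues u (oneTo q)

  Con-split : ∀ a b → Con (a + suc b) f ≡ Con a f ++ u (suc a) ∷ map u (labelsFrom (suc (suc a)) b)
  Con-split a b = begin
    map u (oneTo (a + suc b))                      ≡⟨ cong (map u) (map-+-upTo 1 (a + suc b)) ⟩
    map u (labelsFrom 1 (a + suc b))               ≡⟨ cong (map u) (labelsFrom-+ 1 a (suc b)) ⟩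
    map u (labelsFrom 1 a ++ rest)                 ≡⟨ map-++ u (labelsFrom 1 a) rest ⟩
    map u (labelsFrom 1 a) ++ map u rest           ≡⟨ cong (λ ls → map u ls ++ map u rest) (map-+-upTo 1 a) ⟨
    Con a f ++ u (suc a) ∷ map u (labelsFrom (suc (suc a)) b) ∎
    where
    open ≡-Reasoning
    rest : List ℕ
    rest = labelsFrom (suc a) (suc b)

  usedᵇ-lookup : ∀ x → u (lookup f x) ≡ true
  usedᵇ-lookup x = go f x
    where
    go : ∀ {k} (v : Vec ℕ k) x → any (_≡ᵇ lookup v x) (Vec.toList v) ≡ true
    go (a Vec.∷ v) zero    = cong (_∨ any (_≡ᵇ a) (Vec.toList v)) (Equivalence.to T-≡ (≡⇒≡ᵇ a a refl))
    go (a Vec.∷ v) (suc x) = trans (cong ((a ≡ᵇ lookup v x) ∨_) (go v x)) (∨-zeroʳ _)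

  module _ {q} (f∈ : InRange q f) where

    private
      decompose : ∀ x → ∃ λ a → ∃ λ V → lookup f x ≡ suc a × Con q f ≡ Con a f ++ true ∷ V ×
                                         lookup (deflate f) x ≡ suc (trues (Con a f))
      decompose x with lookup f x in fx≡ | f∈ x
      ... | suc a | _ , a<q = a , _ , refl , Con-q , deflate-x
        where
        open ≡-Reasoning
        used : u (suc a) ≡ true
        used = subst (λ t → u t ≡ true) fx≡ (usedᵇ-lookup x)
        V : List Bool
        V = map u (labelsFrom (suc (suc a)) (q ∸ suc a))
        Con-q : Con q f ≡ Con a f ++ true ∷ V
        Con-q = begin
          Con q f                            ≡⟨ cong (λ t → Con t f) (trans (+-suc a (q ∸ suc a)) (m+[n∸m]≡n a<q)) ⟨
          Con (a + suc (q ∸ suc a)) f        ≡⟨ Con-split a (q ∸ suc a) ⟩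
          Con a f ++ u (suc a) ∷ V           ≡⟨ cong (λ b → Con a f ++ b ∷ V) used ⟩
          Con a f ++ true ∷ V                ∎
        deflate-x : lookup (deflate f) x ≡ suc (trues (Con a f))
        deflate-x = begin
          lookup (deflate f) x                  ≡⟨ lookup-map x _ f ⟩
          usedCount (lookup f x) f              ≡⟨ usedCount≡trues-Con (lookup f x) ⟩
          trues (Con (lookup f x) f)            ≡⟨ cong (λ t → trues (Con t f)) (trans fx≡ (+-comm 1 a)) ⟩
          trues (Con (a + 1) f)                 ≡⟨ cong trues (trans (Con-split a 0) (cong (λ b → Con a f ++ [ b ]) used)) ⟩
          trues (Con a f ++ [ true ])           ≡⟨ trues-∷ʳ (Con a f) true ⟩
          suc (trues (Con a f))                 ∎

    inflate-Con-deflate : inflate (Con q f) (deflate f) ≡ f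
    inflate-Con-deflate = lookup-ext at
      where
      open ≡-Reasoning
      at : ∀ x → lookup (inflate (Con q f) (deflate f)) x ≡ lookup f x
      at x with a , V , fx≡ , Con-q , deflate-x ← decompose x = begin
        lookup (inflate (Con q f) (deflate f)) x              ≡⟨ lookup-map x _ (deflate f) ⟩
        nthTrue (Con q f) (lookup (deflate f) x)              ≡⟨ cong₂ nthTrue Con-q deflate-x ⟩
        nthTrue (Con a f ++ true ∷ V) (suc (trues (Con a f))) ≡⟨ nthTrue-++-true (Con a f) V ⟩
        suc (length (Con a f))                                ≡⟨ cong suc (length-Con a) ⟩
        suc a                                                 ≡⟨ fx≡ ⟨
        lookup f x                                            ∎

    deflate-InRange : InRange (trues (Con q f)) (deflate f)
    deflate-InRange x with decompose x
    ... | a , V , _ , Con-q , deflate-x rewrite deflate-x | Con-q = s≤s z≤n , trues-++-true (Con a f) V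

-- Increasing labelings and swap

∈-oneTo⁻ : ∀ {q a} → a ∈ oneTo q → 1 ≤ a × a ≤ q
∈-oneTo⁻ a∈ with i , i∈ , refl ← ∈-map⁻ suc a∈ = s≤s z≤n , ∈-upTo⁻ i∈

∈-oneTo⁺ : ∀ {q a} → 1 ≤ a × a ≤ q → a ∈ oneTo q
∈-oneTo⁺ {a = suc a} (_ , a<q) = ∈-map⁺ suc (∈-upTo⁺ a<q)

allLabelings-suc : ∀ q n →
  allLabelings q (suc n) ≡ cartesianProductWith (λ v a → a Vec.∷ v) (allLabelings q n) (oneTo q)
allLabelings-suc q n = go (allLabelings q n)
  where
  go : ∀ vs →
    concatMap (λ v → map (λ a → a Vec.∷ v) (oneTo q)) vs ≡ cartesianProductWith (λ v a → a Vec.∷ v) vs (oneTo q)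
  go []       = refl
  go (v ∷ vs) = cong (map (λ a → a Vec.∷ v) (oneTo q) ++_) (go vs)

∈-allLabelings⁻ : ∀ {q n} {g : Labeling n} → g ∈ allLabelings q n → InRange q g
∈-allLabelings⁻ {q} {suc n} g∈ x
  with v , a , v∈ , a∈ , refl ← ∈-cartesianProductWith⁻ (λ v a → a Vec.∷ v) (allLabelings q n) (oneTo q)
                                  (subst (_ ∈_) (allLabelings-suc q n) g∈)
  with x
... | zero  = ∈-oneTo⁻ a∈
... | suc y = ∈-allLabelings⁻ v∈ y

∈-allLabelings⁺ : ∀ {q n} {g : Labeling n} → InRange q g → g ∈ allLabelings q n
∈-allLabelings⁺ {n = zero}  {Vec.[]}      _  = here refl
∈-allLabelings⁺ {q} {suc n} {a Vec.∷ v} g∈ = subst (_ ∈_) (sym (allLabelings-suc q n))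
  (∈-cartesianProductWith⁺ (λ v a → a Vec.∷ v) (∈-allLabelings⁺ {g = v} (g∈ ∘ suc)) (∈-oneTo⁺ (g∈ zero)))

allLabelings-unique : ∀ q n → Unique (allLabelings q n)
allLabelings-unique q zero    = [] ∷ []
allLabelings-unique q (suc n) = subst Unique (sym (allLabelings-suc q n))
  (cartesianProductWith⁺ (λ v a → a Vec.∷ v) (λ eq → Vec.∷-injectiveʳ eq , Vec.∷-injectiveˡ eq)
    (allLabelings-unique q n) (Unique.map⁺ suc-injective (upTo⁺ q)))

module _ {n : ℕ} (P : SelfDualPoset n) where
  open SelfDualPoset P using (_≼_; _≼?_; κ; κ-invol; κ-reversing)

  IsIncreasing : Labeling n → Set
  IsIncreasing g = ∀ x y → T (ltᵇ P x y) → lookup g x < lookup g y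

  isIncᵇ⇒IsIncreasing : ∀ g → T (isIncᵇ P g) → IsIncreasing g
  isIncᵇ⇒IsIncreasing g t x y x<y = <ᵇ⇒< _ _ (T-not-∨⇒→ (All.lookup row (∈-allFin y)) x<y)
    where
    row : All (λ y → T (not (ltᵇ P x y) ∨ (lookup g x <ᵇ lookup g y))) (allFinL n)
    row = all⁺ _ (allFinL n) (All.lookup (all⁺ _ (allFinL n) t) (∈-allFin x))

  IsIncreasing⇒isIncᵇ : ∀ g → IsIncreasing g → T (isIncᵇ P g)
  IsIncreasing⇒isIncᵇ g inc =
    all⁻ _ (tabulate⁺ λ x → all⁻ _ (tabulate⁺ λ y → →⇒T-not-∨ (<⇒<ᵇ ∘ inc x y)))

  ∈-Inc⁻ : ∀ {q g} → g ∈ Inc P q → InRange q g × IsIncreasing g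
  ∈-Inc⁻ {q} {g} g∈ with g∈all , inc ← ∈-filter⁻ (λ f → isIncᵇ P f Bool.≟ true) {xs = allLabelings q n} g∈ =
    ∈-allLabelings⁻ g∈all , isIncᵇ⇒IsIncreasing g (Equivalence.from T-≡ inc)

  ∈-Inc⁺ : ∀ {q} g → InRange q g → IsIncreasing g → g ∈ Inc P q
  ∈-Inc⁺ g g∈ inc =
    ∈-filter⁺ (λ f → isIncᵇ P f Bool.≟ true) (∈-allLabelings⁺ {g = g} g∈) (Equivalence.to T-≡ (IsIncreasing⇒isIncᵇ g inc))

  Inc-unique : ∀ q → Unique (Inc P q)
  Inc-unique q = Unique.filter⁺ (λ f → isIncᵇ P f Bool.≟ true) (allLabelings-unique q n)

  κ-injective : ∀ {x y} → κ x ≡ κ y → x ≡ y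
  κ-injective {x} {y} eq = trans (sym (κ-invol x)) (trans (cong κ eq) (κ-invol y))

  T-ltᵇ⁻ : ∀ {x y} → T (ltᵇ P x y) → x ≼ y × x ≢ y
  T-ltᵇ⁻ {x} {y} t with x ≼? y | x ≟ᶠ y
  ... | yes x≼y | no x≢y = x≼y , x≢y

  T-ltᵇ⁺ : ∀ {x y} → x ≼ y → x ≢ y → T (ltᵇ P x y)
  T-ltᵇ⁺ {x} {y} x≼y x≢y with x ≼? y | x ≟ᶠ y
  ... | yes _   | no _    = _
  ... | yes _   | yes x≡y = x≢y x≡y
  ... | no x⋠y  | _       = x⋠y x≼y

  ltᵇ-κ : ∀ {x y} → T (ltᵇ P x y) → T (ltᵇ P (κ y) (κ x))
  ltᵇ-κ {x} {y} t with x≼y , x≢y ← T-ltᵇ⁻ t = T-ltᵇ⁺ (κ-reversing x y x≼y) (x≢y ∘ κ-injective ∘ sym)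

  lookup-swap : ∀ q g x → lookup (swap P q g) x ≡ suc q ∸ lookup g (κ x)
  lookup-swap q g x = lookup∘tabulate (λ x → suc q ∸ lookup g (κ x)) x

  swap-InRange : ∀ {q} (g : Labeling n) → InRange q g → InRange q (swap P q g)
  swap-InRange {q} g g∈ x rewrite lookup-swap q g x with lookup g (κ x) | g∈ (κ x)
  ... | suc a | _ , a<q = subst (1 ≤_) (sym (+-∸-assoc 1 a<q)) (s≤s z≤n) , m∸n≤m q a

  swap-involutive : ∀ {q} (g : Labeling n) → InRange q g → swap P q (swap P q g) ≡ g
  swap-involutive {q} g g∈ = lookup-ext λ x → begin
    lookup (swap P q (swap P q g)) x          ≡⟨ lookup-swap q (swap P q g) x ⟩
    suc q ∸ lookup (swap P q g) (κ x)         ≡⟨ cong (suc q ∸_) (lookup-swap q g (κ x)) ⟩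
    suc q ∸ (suc q ∸ lookup g (κ (κ x)))      ≡⟨ cong (λ y → suc q ∸ (suc q ∸ lookup g y)) (κ-invol x) ⟩
    suc q ∸ (suc q ∸ lookup g x)              ≡⟨ m∸[m∸n]≡n (m≤n⇒m≤1+n (proj₂ (g∈ x))) ⟩
    lookup g x                                ∎
    where open ≡-Reasoning

  swap-IsIncreasing : ∀ {q} (g : Labeling n) → InRange q g → IsIncreasing g → IsIncreasing (swap P q g)
  swap-IsIncreasing {q} g g∈ inc x y x<y rewrite lookup-swap q g x | lookup-swap q g y =
    ∸-monoʳ-< (inc (κ y) (κ x) (ltᵇ-κ x<y)) (m≤n⇒m≤1+n (proj₂ (g∈ (κ x))))

  swap-InvolutionOn-Inc : ∀ q → InvolutionOn (swap P q) (Inc P q)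
  swap-InvolutionOn-Inc q = record
    { closed     = λ {g} g∈ → let g∈q , inc = ∈-Inc⁻ g∈ in
                     ∈-Inc⁺ (swap P q g) (swap-InRange g g∈q) (swap-IsIncreasing g g∈q inc)
    ; involutive = λ {g} g∈ → swap-involutive g (proj₁ (∈-Inc⁻ g∈))
    }

  antipodal-swap : ∀ {q} x (g : Labeling n) → InRange q g →
                   antipodal P x g + antipodal P x (swap P q g) ≡ suc q + suc q
  antipodal-swap {q} x g g∈ = begin
    (a + b) + (lookup (swap P q g) x + lookup (swap P q g) (κ x))
      ≡⟨ cong₂ (λ s t → (a + b) + (s + t)) (lookup-swap q g x)
               (trans (lookup-swap q g (κ x)) (cong (λ y → suc q ∸ lookup g y) (κ-invol x))) ⟩
    (a + b) + ((suc q ∸ b) + (suc q ∸ a))   ≡⟨ cong ((a + b) +_) (+-comm (suc q ∸ b) (suc q ∸ a)) ⟩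
    (a + b) + ((suc q ∸ a) + (suc q ∸ b))   ≡⟨ interchange a b (suc q ∸ a) (suc q ∸ b) ⟩
    (a + (suc q ∸ a)) + (b + (suc q ∸ b))   ≡⟨ cong₂ _+_ (complement x) (complement (κ x)) ⟩
    suc q + suc q                           ∎
    where
    open ≡-Reasoning
    a : ℕ
    a = lookup g x
    b : ℕ
    b = lookup g (κ x)
    complement : ∀ y → lookup g y + (suc q ∸ lookup g y) ≡ suc q
    complement y = m+[n∸m]≡n (m≤n⇒m≤1+n (proj₂ (g∈ y)))

  κ-InvolutionOn-allFin : InvolutionOn κ (allFinL n)
  κ-InvolutionOn-allFin = record { closed = λ _ → ∈-allFin _ ; involutive = λ _ → κ-invol _ }

  tot-swap : ∀ {q} (g : Labeling n) → InRange q g → tot P g + tot P (swap P q g) ≡ suc q * n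
  tot-swap {q} g g∈ = begin
    tot P g + tot P (swap P q g)
      ≡⟨ cong₂ _+_ (cong sum (toList≡map-lookup g)) (cong sum (toList≡map-lookup (swap P q g))) ⟩
    sum (map (lookup g) X) + sum (map (lookup (swap P q g)) X)
      ≡⟨ cong₂ _+_ (sym (sum-map-involution (allFin⁺ n) κ-InvolutionOn-allFin (lookup g)))
                   (cong sum (List.map-cong (lookup-swap q g) X)) ⟩
    sum (map (lookup g ∘ κ) X) + sum (map (λ x → suc q ∸ lookup g (κ x)) X)
      ≡⟨ sum-map-+ (lookup g ∘ κ) (λ x → suc q ∸ lookup g (κ x)) X ⟨
    sum (map (λ x → lookup g (κ x) + (suc q ∸ lookup g (κ x))) X)
      ≡⟨ sum-map-const _ X (λ {x} _ → m+[n∸m]≡n (m≤n⇒m≤1+n (proj₂ (g∈ (κ x))))) ⟩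
    suc q * length X
      ≡⟨ cong (suc q *_) (List.length-tabulate (λ x → x)) ⟩
    suc q * n ∎
    where
    open ≡-Reasoning
    X : List (Fin n)
    X = allFinL n

-- Swap-closed orbits

module _ {n : ℕ} (P : SelfDualPoset n) where

  orbitList-InRange : ∀ {q m} {f : Labeling n} → InRange q f → ∀ {g} → g ∈ orbitList (Pro P q) f m → InRange q g
  orbitList-InRange {q} f∈ g∈ with k , _ , refl ← ∈-orbitList⁻ (Pro P q) g∈ =
    iter-preserves (Pro P q) (InRange q) (Pro-InRange P) k f∈

  Orbitmesic-swapClosed : ∀ {q c} {O : List (Labeling n)} (stat : Labeling n → ℕ) →
    Unique O → (∀ {g} → g ∈ O → InRange q g) → SwapClosed (swap P q) O →
    (∀ g → InRange q g → stat g + stat (swap P q g) ≡ c) → Orbitmesic stat O (Inc P q)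
  Orbitmesic-swapClosed {q} {O = O} stat O! O∈ closed compl =
    Orbitmesic-complementary stat O! σO (Inc-unique P q) (swap-InvolutionOn-Inc P q)
      (λ {g} g∈ → compl g (O∈ g∈)) (λ {g} g∈ → compl g (proj₁ (∈-Inc⁻ P g∈)))
    where
    σO : InvolutionOn (swap P q) O
    σO = record { closed = closed _ ; involutive = λ {g} g∈ → swap-involutive P g (O∈ g∈) }

  -- By iter-Pro-inflate, every iterate of f = inflate c g₀ is decoded from a pair (power of promotion of g₀
  -- mod m̄, power of ρ mod ℓ).
  module InflatedOrbit (c : List Bool) {g₀ : Labeling n} (g₀∈ : InRange (trues c) g₀)
                       {m̄ ℓ : ℕ} .{{_ : NonZero m̄}} .{{_ : NonZero ℓ}}
                       (orbit̄ : IsOrbitSize (Pro P (trues c)) g₀ m̄) (ρˡ≡id : iter ℓ rot c ≡ c) where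

    private
      q : ℕ
      q = length c
      r : ℕ
      r = trues c
      f : Labeling n
      f = inflate c g₀

    decodePair : Fin m̄ × Fin ℓ → Labeling n
    decodePair (a , b) = inflate (iter (toℕ b) rot c) (iter (toℕ a) (Pro P r) g₀)

    decode : Fin (m̄ * ℓ) → Labeling n
    decode = decodePair ∘ remQuot ℓ

    decode-combine : ∀ {a b} (a<m̄ : a < m̄) (b<ℓ : b < ℓ) →
                     decode (combine (fromℕ< a<m̄) (fromℕ< b<ℓ)) ≡ inflate (iter b rot c) (iter a (Pro P r) g₀)
    decode-combine a<m̄ b<ℓ = trans (cong decodePair (remQuot-combine (fromℕ< a<m̄) (fromℕ< b<ℓ)))
      (cong₂ (λ a b → inflate (iter b rot c) (iter a (Pro P r) g₀)) (toℕ-fromℕ< a<m̄) (toℕ-fromℕ< b<ℓ))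

    code : ℕ → ℕ → Fin (m̄ * ℓ)
    code j a = combine (fromℕ< (m%n<n a m̄)) (fromℕ< (m%n<n j ℓ))

    inflate≡decode : ∀ j a → inflate (iter j rot c) (iter a (Pro P r) g₀) ≡ decode (code j a)
    inflate≡decode j a = begin
      inflate (iter j rot c) (iter a (Pro P r) g₀)
        ≡⟨ cong₂ inflate (iter-%-fixed rot ρˡ≡id j) (iter-%-fixed (Pro P r) (proj₁ (proj₂ orbit̄)) a) ⟩
      inflate (iter (j % ℓ) rot c) (iter (a % m̄) (Pro P r) g₀)
        ≡⟨ decode-combine (m%n<n a m̄) (m%n<n j ℓ) ⟨
      decode (code j a) ∎
      where open ≡-Reasoning

    decode-∈-orbitList : IsOrbitSize (Pro P q) f (m̄ * ℓ) → ∀ y → decode y ∈ orbitList (Pro P q) f (m̄ * ℓ)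
    decode-∈-orbitList orbit = orbitList-∋-decode orbit
      (λ k → code k (proj₁ (iter-Pro-inflate P c g₀∈ k))) decode
      (λ k → let N , eq = iter-Pro-inflate P c g₀∈ k in trans eq (inflate≡decode k N))

    swapClosed : ∀ {i} → IsOrbitSize (Pro P q) f (m̄ * ℓ) → iter i rot c ≡ reverse c →
                 SwapClosed (swap P r) (orbitList (Pro P r) g₀ m̄) → SwapClosed (swap P q) (orbitList (Pro P q) f (m̄ * ℓ))
    swapClosed {i} orbit ρⁱ≡rev closed̄ g g∈
      with k , _ , refl ← ∈-orbitList⁻ (Pro P q) g∈
      with N , iterₖ≡ ← iter-Pro-inflate P c g₀∈ k
      with j , rev≡ ← reverse-iter-rot {i} ρⁱ≡rev k
      with b , _ , iterᵦ≡ ← ∈-orbitList⁻ (Pro P r) (closed̄ _ (iter-∈-orbitList (Pro P r) orbit̄ N)) =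
      subst (_∈ orbitList (Pro P q) f (m̄ * ℓ)) (sym swap≡decode) (decode-∈-orbitList orbit (code j b))
      where
      open ≡-Reasoning
      gₙ : Labeling n
      gₙ = iter N (Pro P r) g₀
      swap≡decode : swap P q (iter k (Pro P q) f) ≡ decode (code j b)
      swap≡decode = begin
        swap P q (iter k (Pro P q) f)                  ≡⟨ cong (swap P q) iterₖ≡ ⟩
        swap P q (inflate (iter k rot c) gₙ)
          ≡⟨ swap-inflate P (iter k rot c) gₙ (length-iter-rot k c) (trues-iter-rot k c)
               (iter-preserves (Pro P r) (InRange r) (Pro-InRange P) N g₀∈) ⟩
        inflate (reverse (iter k rot c)) (swap P r gₙ) ≡⟨ cong₂ inflate rev≡ (sym iterᵦ≡) ⟩
        inflate (iter j rot c) (iter b (Pro P r) g₀)   ≡⟨ inflate≡decode j b ⟩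
        decode (code j b)                              ∎

  inflate-orbit-swapClosed : ∀ c {q r m m̄ ℓ i} {g₀ f : Labeling n} → length c ≡ q → trues c ≡ r →
    InRange (trues c) g₀ → inflate c g₀ ≡ f →
    IsOrbitSize (Pro P q) f m → IsOrbitSize (Pro P r) g₀ m̄ → IsPeriod c ℓ → iter i rot c ≡ reverse c → m ≡ m̄ * ℓ →
    SwapClosed (swap P r) (orbitList (Pro P r) g₀ m̄) → SwapClosed (swap P q) (orbitList (Pro P q) f m)
  inflate-orbit-swapClosed c {m̄ = m̄} {ℓ} {i} refl refl g₀∈ refl
    orbit orbit̄@(s≤s z≤n , _) (s≤s z≤n , ρˡ≡id , _) ρⁱ≡rev refl =
    InflatedOrbit.swapClosed c g₀∈ {m̄} {ℓ} orbit̄ ρˡ≡id {i} orbit ρⁱ≡rev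

corollary5p15 :
    {n : ℕ} (P : SelfDualPoset n) (q : ℕ) (f : Labeling n) → f ∈ Inc P q →
    (m m̄ ℓ r : ℕ) →
    IsOrbitSize (Pro P q) f m →
    r ≡ usedCount q f →
    IsOrbitSize (Pro P r) (deflate f) m̄ →
    IsPeriod (Con q f) ℓ →
    Σ ℕ (λ i → (1 ≤ i) × (i ≤ q) × (iter i rot (Con q f) ≡ reverse (Con q f))) →
    m ≡ m̄ * ℓ →
    SwapClosed (swap P r) (orbitList (Pro P r) (deflate f) m̄) →
    ((x : Fin n) → Orbitmesic (antipodal P x) (orbitList (Pro P q) f m) (Inc P q))
    × Orbitmesic (tot P) (orbitList (Pro P q) f m) (Inc P q)
corollary5p15 P q f f∈ m m̄ ℓ r orbit refl orbit̄ period (i , _ , _ , ρⁱ≡rev) m≡m̄ℓ closed̄ =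
  (λ x → orbitmesic (antipodal P x) (antipodal-swap P x)) , orbitmesic (tot P) (tot-swap P)
  where
  f∈q : InRange q f
  f∈q = proj₁ (∈-Inc⁻ P f∈)
  closed : SwapClosed (swap P q) (orbitList (Pro P q) f m)
  closed = inflate-orbit-swapClosed P (Con q f) {i = i} (length-Con f q) (sym (usedCount≡trues-Con f q))
    (deflate-InRange f f∈q) (inflate-Con-deflate f f∈q) orbit orbit̄ period ρⁱ≡rev m≡m̄ℓ closed̄
  orbitmesic : ∀ stat {c} → (∀ g → InRange q g → stat g + stat (swap P q g) ≡ c) →
               Orbitmesic stat (orbitList (Pro P q) f m) (Inc P q)
  orbitmesic stat = Orbitmesic-swapClosed P stat (orbitList-unique (Pro P q) orbit) (orbitList-InRange P f∈q) closed
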